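{- Let $(v_0,v_1,v_2)$ be a path with 3 vertices, let the two edges $(v_0,v_1)$ and $(v_1,v_2)$ carry arbitrary labels in $\{N,F\}$, and let the threshold be $t=2$, so that an edge $(x,y)$ is satisfied iff ($|c(x)-c(y)|\le 2$ and it is labeled $N$) or ($|c(x)-c(y)|> 2$ and it is labeled $F$). Suppose $c(v_0),c(v_2)\in\{0,\pm1,\pm2,\pm3,\pm4\}$. (a) If $c(v_0)=0$ and $c(v_2)\in\{\pm1,\pm2,\pm3,\pm4\}$, then $c(v_1)$ can be chosen in $\{\pm2,\pm3\}$ so that both edges are satisfied. (b) If $c(v_0)=0$ and $c(v_2)\in\{\pm2,\pm3,\pm4\}$, then $c(v_1)$ can be chosen in $\{\pm2,\pm4\}$ so that both edges are satisfied. (c) If $c(v_0)\in\{1,-1\}$ and $c(v_2)\in\{\pm2,\pm3\}$, then $c(v_1)$ can be chosen in $\{\pm1,\pm4\}$ so that both edges are satisfied.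
   Context: Near ($N$) edges must have endpoint colors differing by at most the threshold $t$, far ($F$) edges by more than $t$. -}

module Defs where

open import Data.Nat using (ℕ)
open import Data.Integer using (ℤ; +_; -_; _-_; ∣_∣)
open import Data.Product using (_×_)
open import Data.Sum using (_⊎_)
import Data.Nat as N
open import Relation.Binary.PropositionalEquality using (_≡_)

data Label : Set where
  N F : Label

t : ℕ
t = 2

Satisfied : Label → ℤ → ℤ → Set
Satisfied N x y = ∣ x - y ∣ N.≤ t
Satisfied F x y = t N.< ∣ x - y ∣

PathSat : Label → Label → ℤ → ℤ → ℤ → Set
PathSat l₁ l₂ c0 c1 c2 = Satisfied l₁ c0 c1 × Satisfied l₂ c1 c2

Pm : ℕ → ℤ → Set
Pm a z = z ≡ + a ⊎ z ≡ - (+ a)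

-- Each part is a finite claim (four label choices, finitely many end colours, four candidate
-- middle colours), so it is decided by evaluation and the middle colour is read off the decision.
module Submission where

open import Defs
open import Data.Empty using (⊥)
open import Data.Integer using (ℤ; +_; -_; _-_; ∣_∣)
import Data.Nat as ℕ
open import Data.List using (List; []; _∷_)
open import Data.List.Membership.Propositional using (_∈_; find)
open import Data.List.Relation.Unary.All as All using (All; all?)
open import Data.List.Relation.Unary.Any using (Any; here; there; any?)
open import Data.Product using (_×_; _,_; ∃-syntax)
open import Data.Sum using (_⊎_; inj₁; inj₂)
open import Relation.Nullary using (Dec)
open import Relation.Nullary.Decidable using (_×-dec_; map′; True; toWitness)
open import Relation.Binary.PropositionalEquality using (_≡_; refl)

satisfied? : (l : Label) (x y : ℤ) → Dec (Satisfied l x y)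
satisfied? N x y = ∣ x - y ∣ ℕ.≤? t
satisfied? F x y = t ℕ.<? ∣ x - y ∣

pathSat? : (l₁ l₂ : Label) (c0 c1 c2 : ℤ) → Dec (PathSat l₁ l₂ c0 c1 c2)
pathSat? l₁ l₂ c0 c1 c2 = satisfied? l₁ c0 c1 ×-dec satisfied? l₂ c1 c2

∀-Label? : {P : Label → Set} → ((l : Label) → Dec (P l)) → Dec ((l : Label) → P l)
∀-Label? P? = map′ (λ { (pN , pF) N → pN ; (pN , pF) F → pF }) (λ p → p N , p F) (P? N ×-dec P? F)

-- Nested on the right without a trailing ⊥, so that PmOneOf (1 ∷ 2 ∷ []) z is
-- definitionally Pm 1 z ⊎ Pm 2 z, the shape used in the theorem.
PmOneOf : List ℕ.ℕ → ℤ → Set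
PmOneOf []           z = ⊥
PmOneOf (a ∷ [])     z = Pm a z
PmOneOf (a ∷ b ∷ as) z = Pm a z ⊎ PmOneOf (b ∷ as) z

±values : List ℕ.ℕ → List ℤ
±values []       = []
±values (a ∷ as) = + a ∷ - (+ a) ∷ ±values as

PmOneOf⇒∈±values : ∀ as {z} → PmOneOf as z → z ∈ ±values as
PmOneOf⇒∈±values (a ∷ [])     (inj₁ refl)          = here refl
PmOneOf⇒∈±values (a ∷ [])     (inj₂ refl)          = there (here refl)
PmOneOf⇒∈±values (a ∷ b ∷ as) (inj₁ (inj₁ refl))   = here refl
PmOneOf⇒∈±values (a ∷ b ∷ as) (inj₁ (inj₂ refl))   = there (here refl)
PmOneOf⇒∈±values (a ∷ b ∷ as) (inj₂ z∈)            = there (there (PmOneOf⇒∈±values (b ∷ as) z∈))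

∈±values⇒PmOneOf : ∀ as {z} → z ∈ ±values as → PmOneOf as z
∈±values⇒PmOneOf (a ∷ [])     (here refl)         = inj₁ refl
∈±values⇒PmOneOf (a ∷ [])     (there (here refl)) = inj₂ refl
∈±values⇒PmOneOf (a ∷ b ∷ as) (here refl)         = inj₁ (inj₁ refl)
∈±values⇒PmOneOf (a ∷ b ∷ as) (there (here refl)) = inj₁ (inj₂ refl)
∈±values⇒PmOneOf (a ∷ b ∷ as) (there (there z∈))  = inj₂ (∈±values⇒PmOneOf (b ∷ as) z∈)

Extensible : List ℤ → ℤ → ℤ → Set
Extensible mids c0 c2 = (l₁ l₂ : Label) → Any (λ c1 → PathSat l₁ l₂ c0 c1 c2) mids

extensible? : (mids : List ℤ) (c0 c2 : ℤ) → Dec (Extensible mids c0 c2)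
extensible? mids c0 c2 =
  ∀-Label? λ l₁ → ∀-Label? λ l₂ → any? (λ c1 → pathSat? l₁ l₂ c0 c1 c2) mids

AllExtensible : List ℤ → List ℤ → List ℤ → Set
AllExtensible c0s c2s mids = All (λ c0 → All (λ c2 → Extensible mids c0 c2) c2s) c0s

allExtensible? : (c0s c2s mids : List ℤ) → Dec (AllExtensible c0s c2s mids)
allExtensible? c0s c2s mids = all? (λ c0 → all? (λ c2 → extensible? mids c0 c2) c2s) c0s

extend : (c0s : List ℤ) (ends mids : List ℕ.ℕ) →
         True (allExtensible? c0s (±values ends) (±values mids)) →
         (l₁ l₂ : Label) {c0 c2 : ℤ} → c0 ∈ c0s → PmOneOf ends c2 →
         ∃[ c1 ] (PmOneOf mids c1 × PathSat l₁ l₂ c0 c1 c2)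
extend c0s ends mids checked l₁ l₂ c0∈ c2∈ =
  let extensible = All.lookup (All.lookup (toWitness checked) c0∈) (PmOneOf⇒∈±values ends c2∈)
      c1 , c1∈ , sat = find (extensible l₁ l₂)
  in c1 , ∈±values⇒PmOneOf mids c1∈ , sat

mainTheorem3 : (l₁ l₂ : Label) →
    ((c0 c2 : ℤ) → c0 ≡ + 0 → (Pm 1 c2 ⊎ Pm 2 c2 ⊎ Pm 3 c2 ⊎ Pm 4 c2) →
    ∃[ c1 ] ((Pm 2 c1 ⊎ Pm 3 c1) × PathSat l₁ l₂ c0 c1 c2))
    × ((c0 c2 : ℤ) → c0 ≡ + 0 → (Pm 2 c2 ⊎ Pm 3 c2 ⊎ Pm 4 c2) →
    ∃[ c1 ] ((Pm 2 c1 ⊎ Pm 4 c1) × PathSat l₁ l₂ c0 c1 c2))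
    × ((c0 c2 : ℤ) → Pm 1 c0 → (Pm 2 c2 ⊎ Pm 3 c2) →
    ∃[ c1 ] ((Pm 1 c1 ⊎ Pm 4 c1) × PathSat l₁ l₂ c0 c1 c2))
mainTheorem3 l₁ l₂ =
    (λ _ _ c0≡0 → extend (+ 0 ∷ []) (1 ∷ 2 ∷ 3 ∷ 4 ∷ []) (2 ∷ 3 ∷ []) _ l₁ l₂ (here c0≡0))
  , (λ _ _ c0≡0 → extend (+ 0 ∷ []) (2 ∷ 3 ∷ 4 ∷ []) (2 ∷ 4 ∷ []) _ l₁ l₂ (here c0≡0))
  , (λ _ _ c0≡±1 → extend (±values (1 ∷ [])) (2 ∷ 3 ∷ []) (1 ∷ 4 ∷ []) _ l₁ l₂
                          (PmOneOf⇒∈±values (1 ∷ []) c0≡±1))
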